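{- Let $\Gamma$ be a semicomplete multipartite commutative weakly distance-regular digraph and let $q$ be such that $(1,q-1)\in\tilde\partial(\Gamma)$. Then $\Gamma_{1,q-1}^2\neq\{\Gamma_{1,q-1}\}$; that is, there exist vertices $x,y,z$ with $(x,y),(y,z)\in\Gamma_{1,q-1}$ and $(x,z)\notin\Gamma_{1,q-1}$.
   Context: A digraph has a finite vertex set and arcs that are ordered pairs of distinct vertices. $\partial(x,y)$ is the length of a shortest directed path from $x$ to $y$; strongly connected means all are finite. $\tilde\partial(x,y)=(\partial(x,y),\partial(y,x))$, $\tilde\partial(\Gamma)$ the set of these pairs, $\Gamma_{a,b}=\{(x,y):\tilde\partial(x,y)=(a,b)\}$. For relations $R,S$ among the $\Gamma_{\tilde i}$, $RS$ denotes the set of those $\Gamma_{\tilde h}$ containing some $(x,y)$ for which there is $z$ with $(x,z)\in R$, $(z,y)\in S$; $R^2=RR$. A strongly connected $\Gamma$ is weakly distance-regular if its arc relation is not symmetric and for all $\tilde i,\tilde j,\tilde h\in\tilde\partial(\Gamma)$ the number $|\{z:(x,z)\in\Gamma_{\tilde i},(z,y)\in\Gamma_{\tilde j}\}|$ is the same for all $(x,y)\in\Gamma_{\tilde h}$; commutative if this number is symmetric in $\tilde i,\tilde j$. $\Gamma$ is semicomplete multipartite if its underlying graph ($x\sim y$ iff $(x,y)$ or $(y,x)$ is an arc) is a complete multipartite graph with at least 2 parts, each of size at least 2. -}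

module Defs where

open import Data.Nat using (ℕ; zero; suc; _≤_; _≟_)
open import Data.Fin using (Fin)
open import Data.Sum using (_⊎_)
open import Data.List using (List; length; filter; allFin)
open import Data.Product using (Σ; ∃; ∃-syntax; _×_; _,_)
open import Relation.Nullary using (¬_)
open import Relation.Nullary.Decidable using (_×-dec_)
open import Relation.Binary.PropositionalEquality using (_≡_; _≢_)

-- A digraph on the finite vertex set Fin n is given by its arc relation A.
-- Arcs are ordered pairs of distinct vertices.
Irreflexive : ∀ {n} → (Fin n → Fin n → Set) → Set
Irreflexive {n} A = ∀ (x : Fin n) → ¬ A x x

data Walk {n} (A : Fin n → Fin n → Set) : Fin n → Fin n → ℕ → Set where
  here : ∀ {x} → Walk A x x 0
  step : ∀ {x y z k} → A x y → Walk A y z k → Walk A x z (suc k)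

-- D is the distance function ∂ of A: D x y is the length of a shortest
-- directed walk (equivalently path) from x to y.  Such a total function
-- exists iff A is strongly connected.
IsDistance : ∀ {n} → (Fin n → Fin n → Set) → (Fin n → Fin n → ℕ) → Set
IsDistance {n} A D =
  (∀ x y → Walk A x y (D x y)) × (∀ x y k → Walk A x y k → D x y ≤ k)

D̃ : ∀ {n} → (Fin n → Fin n → ℕ) → Fin n → Fin n → ℕ × ℕ
D̃ D x y = D x y , D y x

InSpec : ∀ {n} → (Fin n → Fin n → ℕ) → ℕ × ℕ → Set
InSpec {n} D (a , b) = ∃[ x ] ∃[ y ] (D x y ≡ a × D y x ≡ b)

count : ∀ {n} → (Fin n → Fin n → ℕ) → ℕ × ℕ → ℕ × ℕ → Fin n → Fin n → ℕ
count {n} D (i , i') (j , j') x y =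
  length (filter (λ z → ((D x z ≟ i) ×-dec (D z x ≟ i'))
                        ×-dec ((D z y ≟ j) ×-dec (D y z ≟ j')))
                 (allFin n))

NotSymmetric : ∀ {n} → (Fin n → Fin n → Set) → Set
NotSymmetric {n} A = ¬ (∀ (x y : Fin n) → A x y → A y x)

WeaklyDistanceRegular : ∀ {n} → (Fin n → Fin n → Set) → (Fin n → Fin n → ℕ) → Set
WeaklyDistanceRegular {n} A D =
  IsDistance A D × NotSymmetric A ×
  (∀ ĩ j̃ h̃ → InSpec D ĩ → InSpec D j̃ → InSpec D h̃ →
     ∀ x y x' y' → D̃ D x y ≡ h̃ → D̃ D x' y' ≡ h̃ →
       count D ĩ j̃ x y ≡ count D ĩ j̃ x' y')

Commutative : ∀ {n} → (Fin n → Fin n → ℕ) → Set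
Commutative {n} D =
  ∀ ĩ j̃ → InSpec D ĩ → InSpec D j̃ → ∀ (x y : Fin n) →
    count D ĩ j̃ x y ≡ count D j̃ ĩ x y

-- Underlying graph is complete multipartite with at least 2 parts, each of
-- size at least 2: parts are the fibres of part : Fin n → Fin m.
SemicompleteMultipartite : ∀ {n} → (Fin n → Fin n → Set) → Set
SemicompleteMultipartite {n} A =
  Σ ℕ λ m → Σ (Fin n → Fin m) λ part →
    (2 ≤ m) ×
    (∀ (c : Fin m) → ∃[ x ] ∃[ y ] (x ≢ y × part x ≡ c × part y ≡ c)) ×
    (∀ (x y : Fin n) → part x ≢ part y → (A x y ⊎ A y x)) ×
    (∀ (x y : Fin n) → part x ≡ part y → ¬ A x y)

{-# OPTIONS --safe #-}
-- If Γ_{1,q-1} were closed under composition it would be a strict partial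
-- order on the finite vertex set: irreflexive because ∂(x,x) = 0.  But every
-- vertex x has a Γ_{1,q-1}-out-neighbour, since p^{(0,0)}_{(1,q-1),(q-1,1)}(x,x)
-- does not depend on x and is positive at x₀ for any (x₀,y₀) ∈ Γ_{1,q-1};
-- a finite strict order has maximal elements.
module Submission where

open import Defs
open import Data.Nat using (ℕ; suc; _∸_; _<_; _≟_)
open import Data.Nat.Properties using (n≤0⇒n≡0; 0≢1+n)
open import Data.Fin using (Fin)
open import Data.Fin.Induction using (spo-noetherian)
open import Data.Fin.Properties using (any?)
open import Data.List using (List; length; allFin)
open import Data.List.Properties using (filter-some)
open import Data.List.Relation.Unary.All using (All; _∷_)
open import Data.List.Relation.Unary.All.Properties using (all-filter)
open import Data.List.Membership.Propositional using (lose)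
open import Data.List.Membership.Propositional.Properties using (∈-allFin)
open import Data.Product using (∃; ∃-syntax; _×_; _,_; proj₁)
open import Data.Product.Properties using (≡-dec; ×-≡,≡→≡; ×-≡,≡←≡)
open import Data.Empty using (⊥-elim)
open import Function using (flip)
open import Induction.WellFounded using (Acc; acc)
open import Level using (Level)
open import Relation.Binary.Core using (Rel)
open import Relation.Binary.Definitions using (Transitive; Decidable)
open import Relation.Binary.Structures using (IsStrictPartialOrder)
open import Relation.Nullary using (¬_; yes; no)
open import Relation.Nullary.Decidable using (_×-dec_; ¬?; decidable-stable)
open import Relation.Binary.PropositionalEquality
  using (_≡_; _≢_; refl; sym; trans; cong; subst; isEquivalence; resp₂)

module _ {a ℓ : Level} {A : Set a} {_R_ : Rel A ℓ} where

  acc⇒¬serial : ∀ {x} → Acc (flip _R_) x → ¬ (∀ y → ∃ (y R_))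
  acc⇒¬serial {x} (acc rs) serial with serial x
  ... | y , xRy = acc⇒¬serial (rs xRy) serial

module _ {n : ℕ} {ℓ : Level} {_R_ : Rel (Fin n) ℓ} where

  strictPartialOrder⇒¬serial : IsStrictPartialOrder _≡_ _R_ → Fin n →
    ¬ (∀ x → ∃ (x R_))
  strictPartialOrder⇒¬serial spo x = acc⇒¬serial (spo-noetherian spo x)

  ¬transitive⇒∃triple : Decidable _R_ → ¬ Transitive _R_ →
    ∃[ x ] ∃[ y ] ∃[ z ] (x R y × y R z × ¬ (x R z))
  ¬transitive⇒∃triple R? ¬trans
    with any? (λ x → any? (λ y → any? (λ z → R? x y ×-dec R? y z ×-dec ¬? (R? x z))))
  ... | yes triple = triple
  ... | no ¬triple = ⊥-elim (¬trans R-trans)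
    where
    R-trans : Transitive _R_
    R-trans {x} {y} {z} xRy yRz =
      decidable-stable (R? x z) λ ¬xRz → ¬triple (x , y , z , xRy , yRz , ¬xRz)

head-satisfies : ∀ {a p} {A : Set a} {P : A → Set p} {xs : List A} →
  All P xs → 0 < length xs → ∃ P
head-satisfies (px ∷ _) _ = _ , px

module _ {n : ℕ} (D : Fin n → Fin n → ℕ) where

  Γ : ℕ × ℕ → Rel (Fin n) _
  Γ h̃ x y = D̃ D x y ≡ h̃

  Γ? : ∀ h̃ → Decidable (Γ h̃)
  Γ? h̃ x y = ≡-dec _≟_ _≟_ (D̃ D x y) h̃

  count-pos : ∀ {i i' j j'} {x y} z → Γ (i , i') x z → Γ (j , j') z y →
    0 < count D (i , i') (j , j') x y
  count-pos z xz zy = filter-some _ (lose (∈-allFin z) (×-≡,≡←≡ xz , ×-≡,≡←≡ zy))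

  count-pos⇒∃ : ∀ {i i' j j'} {x y} → 0 < count D (i , i') (j , j') x y →
    ∃[ z ] (Γ (i , i') x z × Γ (j , j') z y)
  count-pos⇒∃ pos with head-satisfies (all-filter _ (allFin n)) pos
  ... | z , xz , zy = z , ×-≡,≡→≡ xz , ×-≡,≡→≡ zy

module _ {n : ℕ} {A : Fin n → Fin n → Set} {D : Fin n → Fin n → ℕ} where

  distance-refl : IsDistance A D → ∀ x → D x x ≡ 0
  distance-refl (_ , shortest) x = n≤0⇒n≡0 (shortest x x 0 here)

  Γ-loop : IsDistance A D → ∀ x → Γ D (0 , 0) x x
  Γ-loop dist x = ×-≡,≡→≡ (distance-refl dist x , distance-refl dist x)

  Γ-irreflexive : IsDistance A D → ∀ {a b} x → ¬ Γ D (suc a , b) x x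
  Γ-irreflexive dist x xx = 0≢1+n (trans (sym (distance-refl dist x)) (cong proj₁ xx))

  Γ-serial : WeaklyDistanceRegular A D → ∀ {a b} → InSpec D (a , b) →
    ∀ x → ∃ (Γ D (a , b) x)
  Γ-serial (dist , _ , regular) {a} {b} (x₀ , y₀ , x₀y₀ , y₀x₀) x
    with count-pos⇒∃ D round-trip-x
    where
    round-trip-x₀ : 0 < count D (a , b) (b , a) x₀ x₀
    round-trip-x₀ = count-pos D y₀ (×-≡,≡→≡ (x₀y₀ , y₀x₀)) (×-≡,≡→≡ (y₀x₀ , x₀y₀))
    round-trip-x : 0 < count D (a , b) (b , a) x x
    round-trip-x = subst (0 <_)
      (regular (a , b) (b , a) (0 , 0)
        (x₀ , y₀ , x₀y₀ , y₀x₀) (y₀ , x₀ , y₀x₀ , x₀y₀)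
        (x₀ , x₀ , distance-refl dist x₀ , distance-refl dist x₀)
        x₀ x₀ x x (Γ-loop dist x₀) (Γ-loop dist x))
      round-trip-x₀
  ... | z , xz , _ = z , xz

  Γ-¬transitive : WeaklyDistanceRegular A D → ∀ {a b} → InSpec D (suc a , b) →
    ¬ Transitive (Γ D (suc a , b))
  Γ-¬transitive wdr@(dist , _) spec@(x₀ , _) Γ-trans =
    strictPartialOrder⇒¬serial spo x₀ (Γ-serial wdr spec)
    where
    spo : IsStrictPartialOrder _≡_ (Γ D _)
    spo = record
      { isEquivalence = isEquivalence
      ; irrefl = λ { {x} refl → Γ-irreflexive dist x }
      ; trans = Γ-trans
      ; <-resp-≈ = resp₂ _
      }

lemma4p12 : (n : ℕ) (A : Fin n → Fin n → Set) (D : Fin n → Fin n → ℕ) →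
    Irreflexive A → SemicompleteMultipartite A →
    WeaklyDistanceRegular A D → Commutative D →
    (q : ℕ) → InSpec D (1 , q ∸ 1) →
    ∃[ x ] ∃[ y ] ∃[ z ]
      (D̃ D x y ≡ (1 , q ∸ 1) × D̃ D y z ≡ (1 , q ∸ 1) × D̃ D x z ≢ (1 , q ∸ 1))
lemma4p12 _ _ D _ _ wdr _ _ spec = ¬transitive⇒∃triple (Γ? D _) (Γ-¬transitive wdr spec)
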